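{- Let NQUEENS be the program consisting of the four clauses $pqs(0,\_,\_,\_).$ $pqs(s(I),Cs,Us,[\_|Ds]) \gets pqs(I,Cs,[\_|Us],Ds),\ pq(s(I),Cs,Us,Ds).$ $pq(I,[I|\_],[I|\_],[I|\_]).$ $pq(I,[\_|Cs],[\_|Us],[\_|Ds]) \gets pq(I,Cs,Us,Ds).$ Then NQUEENS is weakly occur-check free, under any selection rule, for any 1-ground query.
   Context: Each occurrence of $\_$ denotes a distinct fresh variable; upper-case identifiers are variables; $[H|T]$ is list notation. A query is 1-ground if in each of its atoms the first argument is ground. MMA (Martelli–Montanari algorithm) operates on a finite equation set by nondeterministically choosing an equation and applying: (1) $f(s_1,\ldots,s_n)\doteq f(t_1,\ldots,t_n)$ → replace by $s_i\doteq t_i$; (2) $f(\ldots)\doteq g(\ldots)$, $f\ne g$ → fail; (3) $X\doteq X$ → delete; (4) $t\doteq X$, $t$ not a variable → replace by $X\doteq t$; (5) $X\doteq t$, $X\notin Var(t)$, $X$ occurring elsewhere → apply $\{X/t\}$ to all other equations; (6) $X\doteq t$, $X\in Var(t)$, $X\ne t$ → fail. An equation set is WNSTO if some run of MMA on it does not perform action (6). In an SLD-tree for a program $P$ with query $Q$, the unification $\{A\doteq H\}$ is available if $A$ is the selected atom of a query in the tree and $H$ is a standardized-apart head of a clause of $P$ with the same predicate symbol. $P$ with $Q$ is weakly occur-check free (under a selection rule) if all unifications available in the SLD-tree for $P$ with $Q$ are WNSTO. -}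

module Defs where

open import Data.Nat using (ℕ; zero; suc)
open import Data.Fin using (Fin; toℕ)
open import Data.Bool using (if_then_else_)
open import Data.Nat using (_≡ᵇ_)
open import Data.List using (List; []; _∷_; _++_; map; zip; length; take; drop; lookup)
open import Data.List.Relation.Unary.Any using (Any)
open import Data.List.Relation.Unary.All using (All)
open import Data.List.Membership.Propositional using (_∈_)
open import Data.Product using (_×_; _,_; Σ; ∃; ∃-syntax; Σ-syntax)
open import Data.Sum using (_⊎_)
open import Relation.Nullary using (¬_)
open import Relation.Binary.PropositionalEquality using (_≡_; _≢_)

-- Variables and function symbols are named by ℕ;
-- the arity of a function symbol is the length of its argument list
-- (symbols with the same name but different arity are different).

data Term : Set where
  var : ℕ → Term
  fn  : ℕ → List Term → Term

Subst : Set
Subst = ℕ → Term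

mutual
  _⟨_⟩ : Term → Subst → Term
  var x   ⟨ σ ⟩ = σ x
  fn f ts ⟨ σ ⟩ = fn f (ts ⟨ σ ⟩*)

  _⟨_⟩* : List Term → Subst → List Term
  []       ⟨ σ ⟩* = []
  (t ∷ ts) ⟨ σ ⟩* = t ⟨ σ ⟩ ∷ ts ⟨ σ ⟩*

data _∈ᵥ_ (x : ℕ) : Term → Set where
  here   : x ∈ᵥ var x
  inside : ∀ {f ts} → Any (x ∈ᵥ_) ts → x ∈ᵥ fn f ts

Ground : Term → Set
Ground t = ∀ x → ¬ (x ∈ᵥ t)

-- Equations and the Martelli–Montanari algorithm.
-- An equation set is represented by a list of equations; the
-- nondeterministic choice of an equation is a split E ≡ L ++ e ∷ R.

Eqn : Set
Eqn = Term × Term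

_∈ₑ_ : ℕ → Eqn → Set
x ∈ₑ (s , t) = x ∈ᵥ s ⊎ x ∈ᵥ t

[_↦_] : ℕ → Term → Subst
[ x ↦ t ] y = if y ≡ᵇ x then t else var y

substEq : ℕ → Term → Eqn → Eqn
substEq x t (l , r) = (l ⟨ [ x ↦ t ] ⟩ , r ⟨ [ x ↦ t ] ⟩)

data MMAStep (E : List Eqn) : List Eqn → Set where
  act1 : ∀ L R f ss ts → E ≡ L ++ (fn f ss , fn f ts) ∷ R →
         length ss ≡ length ts → MMAStep E (L ++ zip ss ts ++ R)
  act3 : ∀ L R x → E ≡ L ++ (var x , var x) ∷ R → MMAStep E (L ++ R)
  act4 : ∀ L R f ts x → E ≡ L ++ (fn f ts , var x) ∷ R →
         MMAStep E (L ++ (var x , fn f ts) ∷ R)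
  act5 : ∀ L R x t → E ≡ L ++ (var x , t) ∷ R → ¬ (x ∈ᵥ t) →
         Any (x ∈ₑ_) (L ++ R) →
         MMAStep E (map (substEq x t) L ++ (var x , t) ∷ map (substEq x t) R)

data Clash (E : List Eqn) : Set where
  act2 : ∀ L R f g ss ts → E ≡ L ++ (fn f ss , fn g ts) ∷ R →
         (f ≢ g ⊎ length ss ≢ length ts) → Clash E

data OccurFail (E : List Eqn) : Set where
  act6 : ∀ L R x t → E ≡ L ++ (var x , t) ∷ R → x ∈ᵥ t → t ≢ var x →
         OccurFail E

-- NoOccurRun E : there is a (complete, hence finite) run of MMA
-- starting from E which never performs action (6).
data NoOccurRun (E : List Eqn) : Set where
  stop  : (∀ E' → ¬ MMAStep E E') → ¬ Clash E → ¬ OccurFail E →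
          NoOccurRun E
  clash : Clash E → NoOccurRun E
  step  : ∀ {E'} → MMAStep E E' → NoOccurRun E' → NoOccurRun E

WNSTO : List Eqn → Set
WNSTO = NoOccurRun

record Atom : Set where
  constructor _⦅_⦆
  field
    pred : ℕ
    args : List Term
open Atom public

atomTerm : Atom → Term
atomTerm A = fn (pred A) (args A)

_⟨_⟩ₐ : Atom → Subst → Atom
A ⟨ σ ⟩ₐ = pred A ⦅ args A ⟨ σ ⟩* ⦆

Query : Set
Query = List Atom

_⟨_⟩q : Query → Subst → Query
Q ⟨ σ ⟩q = map (λ A → A ⟨ σ ⟩ₐ) Q

record Clause : Set where
  constructor _⇐_
  field
    head : Atom
    body : List Atom
open Clause public

Program : Set
Program = List Clause

_⟨_⟩c : Clause → Subst → Clause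
c ⟨ σ ⟩c = (head c ⟨ σ ⟩ₐ) ⇐ (body c ⟨ σ ⟩q)

_∈ₐ_ : ℕ → Atom → Set
x ∈ₐ A = Any (x ∈ᵥ_) (args A)

_∈q_ : ℕ → Query → Set
x ∈q Q = Any (x ∈ₐ_) Q

_∈c_ : ℕ → Clause → Set
x ∈c c = x ∈ₐ head c ⊎ x ∈q body c

_∈σ_ : ℕ → Subst → Set
x ∈σ θ = (θ x ≢ var x) ⊎ (∃[ y ] (θ y ≢ var y × x ∈ᵥ θ y))

Variant : Clause → Clause → Set
Variant c' c = Σ[ ρ ∈ (ℕ → ℕ) ] ((∀ {x y} → ρ x ≡ ρ y → x ≡ y) × c' ≡ c ⟨ (λ x → var (ρ x)) ⟩c)

MGU : Subst → Atom → Atom → Set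
MGU θ A H = (A ⟨ θ ⟩ₐ ≡ H ⟨ θ ⟩ₐ) ×
            (∀ σ → A ⟨ σ ⟩ₐ ≡ H ⟨ σ ⟩ₐ → ∃[ δ ] (∀ x → σ x ≡ θ x ⟨ δ ⟩))

record DStep : Set where
  constructor dstep
  field
    query   : Query
    variant : Clause
    mgu     : Subst
open DStep public

-- history of a derivation fragment, most recent step first
History : Set
History = List DStep

_∈h_ : ℕ → History → Set
x ∈h h = Any (λ s → x ∈q query s ⊎ x ∈c variant s ⊎ x ∈σ mgu s) h

-- a selection rule selects an atom of the last (nonempty) query of a
-- derivation fragment, given the fragment
SelRule : Set
SelRule = (h : History) (A : Atom) (As : List Atom) → Fin (length (A ∷ As))

StandardizedApart : Clause → History → Query → Set
StandardizedApart c' h Q = ∀ x → x ∈c c' → ¬ (x ∈h h) × ¬ (x ∈q Q)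

replaceAt : {X : Set} → List X → ℕ → List X → List X
replaceAt xs i ys = take i xs ++ ys ++ drop (suc i) xs

-- nodes of the SLD-tree for P with Q₀ under R (for any choice of
-- standardized-apart variants and mgus)
data Node (P : Program) (R : SelRule) (Q₀ : Query) : History → Query → Set where
  root  : Node P R Q₀ [] Q₀
  child : ∀ {h A As c c' θ} → Node P R Q₀ h (A ∷ As) →
          c ∈ P → Variant c' c → StandardizedApart c' h (A ∷ As) →
          MGU θ (lookup (A ∷ As) (R h A As)) (head c') →
          Node P R Q₀ (dstep (A ∷ As) c' θ ∷ h)
               (replaceAt (A ∷ As) (toℕ (R h A As)) (body c') ⟨ θ ⟩q)

Available : Program → SelRule → Query → Atom → Atom → Set
Available P R Q₀ A H =
  ∃[ h ] ∃[ B ] ∃[ Bs ] (Node P R Q₀ h (B ∷ Bs) ×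
    A ≡ lookup (B ∷ Bs) (R h B Bs) ×
    ∃[ c ] ∃[ c' ] (c ∈ P × Variant c' c × StandardizedApart c' h (B ∷ Bs) ×
      H ≡ head c' × pred A ≡ pred H))

WeaklyOccurCheckFree : Program → SelRule → Query → Set
WeaklyOccurCheckFree P R Q₀ =
  ∀ A H → Available P R Q₀ A H → WNSTO ((atomTerm A , atomTerm H) ∷ [])

OneGroundAtom : Atom → Set
OneGroundAtom A = All Ground (take 1 (args A))

OneGround : Query → Set
OneGround Q = All OneGroundAtom Q

-- The program NQUEENS.
-- function symbols: 0 ↦ name 0 (arity 0), s ↦ name 1 (arity 1),
-- [_|_] ↦ name 2 (arity 2).  predicates: pqs ↦ 0, pq ↦ 1.

zeroT : Term
zeroT = fn 0 []

sT : Term → Term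
sT t = fn 1 (t ∷ [])

cons : Term → Term → Term
cons h t = fn 2 (h ∷ t ∷ [])

v : ℕ → Term
v = var

pqs : Term → Term → Term → Term → Atom
pqs a b c d = 0 ⦅ a ∷ b ∷ c ∷ d ∷ [] ⦆

pq : Term → Term → Term → Term → Atom
pq a b c d = 1 ⦅ a ∷ b ∷ c ∷ d ∷ [] ⦆

NQUEENS : Program
NQUEENS =
  (pqs zeroT (v 0) (v 1) (v 2) ⇐ []) ∷
  (pqs (sT (v 0)) (v 1) (v 2) (cons (v 3) (v 4)) ⇐
     (pqs (v 0) (v 1) (cons (v 5) (v 2)) (v 4) ∷
      pq (sT (v 0)) (v 1) (v 2) (v 4) ∷ [])) ∷
  (pq (v 0) (cons (v 0) (v 1)) (cons (v 0) (v 2)) (cons (v 0) (v 3)) ⇐ []) ∷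
  (pq (v 0) (cons (v 1) (v 2)) (cons (v 3) (v 4)) (cons (v 5) (v 6)) ⇐
     (pq (v 0) (v 2) (v 4) (v 6) ∷ [])) ∷
  []

{-# OPTIONS --safe #-}
module Submission where

-- Every unification available in the tree has the form A ≐ H, where A is the
-- selected atom of a query and H is a renamed clause head sharing no variable
-- with A.  All queries in the tree are 1-ground: in each clause the first
-- argument of every body atom is a subterm of the first argument of the head,
-- which the mgu makes ground.  Three of the four heads are linear, and MMA
-- never reaches action (6) on a linear term against a variable-disjoint one:
-- it keeps an invariant in which solved equations X ≐ t have X occurring
-- nowhere else, and every variable of the right-hand side of an unsolved
-- equation occurs exactly once in the whole set; the total size of the
-- unsolved right-hand sides decreases.  In the head pq(I,[I|_],[I|_],[I|_])
-- only I is repeated, and it faces the ground first argument of A; binding I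
-- first leaves a system satisfying the invariant.

open import Data.Bool using (true; false; if_then_else_)
open import Data.Empty using (⊥-elim)
open import Data.Fin using (toℕ)
open import Data.List using (List; []; _∷_; _++_; map; zip; length; take)
open import Data.List.Membership.Propositional using (_∈_; lose; find)
open import Data.List.Membership.Propositional.Properties using (∈-insert; ∈-++⁺ˡ; ∈-++⁺ʳ; ∈-lookup)
open import Data.List.Properties using (map-++; ++-assoc; ++-identityʳ)
open import Data.List.Relation.Unary.All using (All; []; _∷_)
import Data.List.Relation.Unary.All as All
open import Data.List.Relation.Unary.All.Properties using (++⁺; map⁺; take⁺; drop⁺)
open import Data.List.Relation.Unary.Any using (Any; here; there)
open import Data.Nat using (ℕ; zero; suc; _+_; _≤_; _<_; z≤n; s≤s; _≡ᵇ_; _≟_)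
open import Data.Nat.ListAction using (sum)
open import Data.Nat.ListAction.Properties using (sum-++)
open import Data.Nat.Properties
open import Algebra.Properties.CommutativeSemigroup +-commutativeSemigroup using (x∙yz≈y∙xz; interchange)
open import Data.Product using (_×_; _,_; proj₁; proj₂; ∃-syntax)
open import Data.Sum using (_⊎_; inj₁; inj₂)
open import Function using (_∘_)
open import Function.Definitions using (Injective)
open import Relation.Binary.PropositionalEquality
open import Relation.Nullary using (¬_; yes; no; proof)
open import Relation.Nullary.Reflects using (Reflects; ofʸ; ofⁿ)

open import Defs

+-pos : ∀ m n → 0 < m + n → 0 < m ⊎ 0 < n
+-pos zero    n pos = inj₂ pos
+-pos (suc m) n _   = inj₁ (s≤s z≤n)

m+n≡1⇒m≡0 : ∀ m {n} → m + n ≡ 1 → 0 < n → m ≡ 0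
m+n≡1⇒m≡0 m {suc n} eq _ = m+n≡0⇒m≡0 m (suc-injective (trans (sym (+-suc m n)) eq))

-- _≟_ on ℕ is implemented through _≡ᵇ_, so its proof component reflects x ≡ᵇ y.
≡ᵇ-reflects : ∀ x y → Reflects (x ≡ y) (x ≡ᵇ y)
≡ᵇ-reflects x y = proof (x ≟ y)

[↦]-self : ∀ x t → [ x ↦ t ] x ≡ t
[↦]-self x t with x ≡ᵇ x | ≡ᵇ-reflects x x
... | true  | _       = refl
... | false | ofⁿ x≢x = ⊥-elim (x≢x refl)

[↦]-other : ∀ {x y} t → y ≢ x → [ x ↦ t ] y ≡ var y
[↦]-other {x} {y} t y≢x with y ≡ᵇ x | ≡ᵇ-reflects y x
... | true  | ofʸ y≡x = ⊥-elim (y≢x y≡x)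
... | false | _       = refl

δ : ℕ → ℕ → ℕ
δ x y = if x ≡ᵇ y then 1 else 0

δ-self : ∀ x → δ x x ≡ 1
δ-self x with x ≡ᵇ x | ≡ᵇ-reflects x x
... | true  | _       = refl
... | false | ofⁿ x≢x = ⊥-elim (x≢x refl)

δ-other : ∀ {x y} → x ≢ y → δ x y ≡ 0
δ-other {x} {y} x≢y with x ≡ᵇ y | ≡ᵇ-reflects x y
... | true  | ofʸ x≡y = ⊥-elim (x≢y x≡y)
... | false | _       = refl

δ-pos⇒≡ : ∀ {x y} → 0 < δ x y → x ≡ y
δ-pos⇒≡ {x} {y} pos with x ≡ᵇ y | ≡ᵇ-reflects x y
... | true | ofʸ x≡y = x≡y

δ≡0⇒≢ : ∀ {x y} → δ x y ≡ 0 → x ≢ y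
δ≡0⇒≢ {x} δ≡0 refl = 1+n≢0 (trans (sym (δ-self x)) δ≡0)

-- Occurrence counts

mutual
  occ : ℕ → Term → ℕ
  occ x (var y)   = δ x y
  occ x (fn f ts) = occ* x ts

  occ* : ℕ → List Term → ℕ
  occ* x []       = 0
  occ* x (t ∷ ts) = occ x t + occ* x ts

occₑ : ℕ → Eqn → ℕ
occₑ x (s , t) = occ x s + occ x t

occE : ℕ → List Eqn → ℕ
occE x E = sum (map (occₑ x) E)

occE-++ : ∀ x L R → occE x (L ++ R) ≡ occE x L + occE x R
occE-++ x L R = trans (cong sum (map-++ (occₑ x) L R)) (sum-++ (map (occₑ x) L) _)

occE-middle : ∀ x L e R → occE x (L ++ e ∷ R) ≡ occₑ x e + occE x (L ++ R)
occE-middle x L e R = begin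
  occE x (L ++ e ∷ R)              ≡⟨ occE-++ x L (e ∷ R) ⟩
  occE x L + (occₑ x e + occE x R) ≡⟨ x∙yz≈y∙xz (occE x L) (occₑ x e) (occE x R) ⟩
  occₑ x e + (occE x L + occE x R) ≡⟨ cong (occₑ x e +_) (occE-++ x L R) ⟨
  occₑ x e + occE x (L ++ R)       ∎
  where open ≡-Reasoning

occE-zip : ∀ x as ts → length as ≡ length ts → occE x (zip as ts) ≡ occ* x as + occ* x ts
occE-zip x []       []       _   = refl
occE-zip x (a ∷ as) (t ∷ ts) len = begin
  occₑ x (a , t) + occE x (zip as ts)
    ≡⟨ cong (occₑ x (a , t) +_) (occE-zip x as ts (suc-injective len)) ⟩
  (occ x a + occ x t) + (occ* x as + occ* x ts)
    ≡⟨ interchange (occ x a) (occ x t) (occ* x as) (occ* x ts) ⟩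
  occ* x (a ∷ as) + occ* x (t ∷ ts)
    ∎
  where open ≡-Reasoning

mutual
  ∈⇒occ-pos : ∀ {x t} → x ∈ᵥ t → 0 < occ x t
  ∈⇒occ-pos {x} here       = ≤-reflexive (sym (δ-self x))
  ∈⇒occ-pos     (inside p) = ∈*⇒occ*-pos p

  ∈*⇒occ*-pos : ∀ {x ts} → Any (x ∈ᵥ_) ts → 0 < occ* x ts
  ∈*⇒occ*-pos (here p)  = ≤-trans (∈⇒occ-pos p) (m≤m+n _ _)
  ∈*⇒occ*-pos (there p) = ≤-trans (∈*⇒occ*-pos p) (m≤n+m _ _)

mutual
  occ-pos⇒∈ : ∀ {x} t → 0 < occ x t → x ∈ᵥ t
  occ-pos⇒∈ {x} (var y) pos with δ-pos⇒≡ {x} {y} pos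
  ... | refl = here
  occ-pos⇒∈     (fn f ts) pos = inside (occ*-pos⇒∈* ts pos)

  occ*-pos⇒∈* : ∀ {x} ts → 0 < occ* x ts → Any (x ∈ᵥ_) ts
  occ*-pos⇒∈* {x} (t ∷ ts) pos with +-pos (occ x t) (occ* x ts) pos
  ... | inj₁ pos-t  = here (occ-pos⇒∈ t pos-t)
  ... | inj₂ pos-ts = there (occ*-pos⇒∈* ts pos-ts)

∉⇒occ≡0 : ∀ {x} t → ¬ (x ∈ᵥ t) → occ x t ≡ 0
∉⇒occ≡0 {x} t x∉t with occ x t ≟ 0
... | yes occ≡0 = occ≡0
... | no  occ≢0 = ⊥-elim (x∉t (occ-pos⇒∈ t (n≢0⇒n>0 occ≢0)))

occₑ≤occE : ∀ x {e} E → e ∈ E → occₑ x e ≤ occE x E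
occₑ≤occE x (e ∷ E) (here refl) = m≤m+n _ _
occₑ≤occE x (e ∷ E) (there e∈E) = ≤-trans (occₑ≤occE x E e∈E) (m≤n+m _ _)

lhs-occurs : ∀ x {e} E → e ∈ E → 0 < occ x (proj₁ e) → 0 < occE x E
lhs-occurs x {l , r} E e∈E x∈l = ≤-trans x∈l (≤-trans (m≤m+n (occ x l) (occ x r)) (occₑ≤occE x E e∈E))

rhs-occurs : ∀ x {e} E → e ∈ E → 0 < occ x (proj₂ e) → 0 < occE x E
rhs-occurs x {l , r} E e∈E x∈r = ≤-trans x∈r (≤-trans (m≤n+m (occ x r) (occ x l)) (occₑ≤occE x E e∈E))

∈ₑ⇒occE-pos : ∀ {x} E → Any (x ∈ₑ_) E → 0 < occE x E
∈ₑ⇒occE-pos {x} E x∈E with find x∈E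
... | _ , e∈E , inj₁ x∈l = lhs-occurs x E e∈E (∈⇒occ-pos x∈l)
... | _ , e∈E , inj₂ x∈r = rhs-occurs x E e∈E (∈⇒occ-pos x∈r)

occE-pos⇒∈ₑ : ∀ {x} E → 0 < occE x E → Any (x ∈ₑ_) E
occE-pos⇒∈ₑ {x} ((s , t) ∷ E) pos with +-pos (occₑ x (s , t)) (occE x E) pos
... | inj₂ pos-E = there (occE-pos⇒∈ₑ E pos-E)
... | inj₁ pos-e with +-pos (occ x s) (occ x t) pos-e
...   | inj₁ pos-s = here (inj₁ (occ-pos⇒∈ s pos-s))
...   | inj₂ pos-t = here (inj₂ (occ-pos⇒∈ t pos-t))

once-elsewhere⇒absent-here : ∀ x L e R → occE x (L ++ e ∷ R) ≡ 1 → 0 < occE x (L ++ R) → occₑ x e ≡ 0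
once-elsewhere⇒absent-here x L e R once = m+n≡1⇒m≡0 _ (trans (sym (occE-middle x L e R)) once)

bound-once : ∀ x L t R → occE x (L ++ (var x , t) ∷ R) ≡ 1 → occ x t ≡ 0 × occE x (L ++ R) ≡ 0
bound-once x L t R once = m+n≡0⇒m≡0 (occ x t) rest≡0 , m+n≡0⇒n≡0 (occ x t) rest≡0
  where
  rest≡0 : occ x t + occE x (L ++ R) ≡ 0
  rest≡0 = suc-injective (begin
    suc (occ x t) + occE x (L ++ R)       ≡⟨ cong (λ n → (n + occ x t) + occE x (L ++ R)) (δ-self x) ⟨
    occₑ x (var x , t) + occE x (L ++ R)  ≡⟨ occE-middle x L (var x , t) R ⟨
    occE x (L ++ (var x , t) ∷ R)         ≡⟨ once ⟩
    1                                     ∎)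
    where open ≡-Reasoning

-- Instantiation by {x/s}

mutual
  occ-[↦]-other : ∀ {x y s} t → y ≢ x → occ y s ≡ 0 → occ y (t ⟨ [ x ↦ s ] ⟩) ≡ occ y t
  occ-[↦]-other {x} {y} {s} (var w) y≢x y∉s with w ≟ x
  ... | yes refl rewrite [↦]-self x s = trans y∉s (sym (δ-other y≢x))
  ... | no  w≢x  rewrite [↦]-other s w≢x = refl
  occ-[↦]-other (fn f ts) y≢x y∉s = occ*-[↦]-other ts y≢x y∉s

  occ*-[↦]-other : ∀ {x y s} ts → y ≢ x → occ y s ≡ 0 → occ* y (ts ⟨ [ x ↦ s ] ⟩*) ≡ occ* y ts
  occ*-[↦]-other []       y≢x y∉s = refl
  occ*-[↦]-other (t ∷ ts) y≢x y∉s = cong₂ _+_ (occ-[↦]-other t y≢x y∉s) (occ*-[↦]-other ts y≢x y∉s)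

mutual
  occ-[↦]-self : ∀ {x s} t → occ x s ≡ 0 → occ x (t ⟨ [ x ↦ s ] ⟩) ≡ 0
  occ-[↦]-self {x} {s} (var w) x∉s with w ≟ x
  ... | yes refl rewrite [↦]-self x s = x∉s
  ... | no  w≢x  rewrite [↦]-other s w≢x = δ-other (≢-sym w≢x)
  occ-[↦]-self (fn f ts) x∉s = occ*-[↦]-self ts x∉s

  occ*-[↦]-self : ∀ {x s} ts → occ x s ≡ 0 → occ* x (ts ⟨ [ x ↦ s ] ⟩*) ≡ 0
  occ*-[↦]-self []       x∉s = refl
  occ*-[↦]-self (t ∷ ts) x∉s = cong₂ _+_ (occ-[↦]-self t x∉s) (occ*-[↦]-self ts x∉s)

mutual
  [↦]-fresh : ∀ {x s} t → occ x t ≡ 0 → t ⟨ [ x ↦ s ] ⟩ ≡ t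
  [↦]-fresh {x} {s} (var w) x∉w = [↦]-other s (≢-sym (δ≡0⇒≢ x∉w))
  [↦]-fresh (fn f ts) x∉ts = cong (fn f) ([↦]*-fresh ts x∉ts)

  [↦]*-fresh : ∀ {x s} ts → occ* x ts ≡ 0 → ts ⟨ [ x ↦ s ] ⟩* ≡ ts
  [↦]*-fresh         []       _      = refl
  [↦]*-fresh {x} (t ∷ ts) x∉t∷ts =
    cong₂ _∷_ ([↦]-fresh t (m+n≡0⇒m≡0 (occ x t) x∉t∷ts))
              ([↦]*-fresh ts (m+n≡0⇒n≡0 (occ x t) x∉t∷ts))

occE-[↦]-other : ∀ {x y s} E → y ≢ x → occ y s ≡ 0 → occE y (map (substEq x s) E) ≡ occE y E
occE-[↦]-other []            y≢x y∉s = refl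
occE-[↦]-other ((l , r) ∷ E) y≢x y∉s =
  cong₂ _+_ (cong₂ _+_ (occ-[↦]-other l y≢x y∉s) (occ-[↦]-other r y≢x y∉s)) (occE-[↦]-other E y≢x y∉s)

occE-[↦]-self : ∀ {x s} E → occ x s ≡ 0 → occE x (map (substEq x s) E) ≡ 0
occE-[↦]-self []            x∉s = refl
occE-[↦]-self ((l , r) ∷ E) x∉s =
  cong₂ _+_ (cong₂ _+_ (occ-[↦]-self l x∉s) (occ-[↦]-self r x∉s)) (occE-[↦]-self E x∉s)

-- MMA runs that never perform action (6)

mutual
  size : Term → ℕ
  size (var _)   = 1
  size (fn f ts) = suc (size* ts)

  size* : List Term → ℕ
  size* []       = 0
  size* (t ∷ ts) = size t + size* ts

size-pos : ∀ t → 0 < size t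
size-pos (var _)  = s≤s z≤n
size-pos (fn _ _) = s≤s z≤n

rhsSize : List Eqn → ℕ
rhsSize E = sum (map (λ e → size (proj₂ e)) E)

rhsSize-++ : ∀ L R → rhsSize (L ++ R) ≡ rhsSize L + rhsSize R
rhsSize-++ L R = trans (cong sum (map-++ _ L R)) (sum-++ (map (λ e → size (proj₂ e)) L) _)

rhsSize-zip : ∀ as ts → rhsSize (zip as ts) ≤ size* ts
rhsSize-zip []       ts       = z≤n
rhsSize-zip (a ∷ as) []       = z≤n
rhsSize-zip (a ∷ as) (t ∷ ts) = +-monoʳ-≤ (size t) (rhsSize-zip as ts)

rhsSize-[↦]-fresh : ∀ {x s} E → All (λ e → occ x (proj₂ e) ≡ 0) E →
                    rhsSize (map (substEq x s) E) ≡ rhsSize E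
rhsSize-[↦]-fresh []            []           = refl
rhsSize-[↦]-fresh ((l , r) ∷ E) (x∉r ∷ x∉E) =
  cong₂ _+_ (cong size ([↦]-fresh r x∉r)) (rhsSize-[↦]-fresh E x∉E)

Solved : List Eqn → Eqn → Set
Solved E e = ∃[ z ] (proj₁ e ≡ var z × occE z E ≡ 1)

RhsLinear : List Eqn → Eqn → Set
RhsLinear E e = ∀ x → 0 < occ x (proj₂ e) → occE x E ≡ 1

record Invariant (S U : List Eqn) : Set where
  field
    solved    : All (Solved (S ++ U)) S
    rhsLinear : All (RhsLinear (S ++ U)) U
open Invariant

record SameOccurrences (E E′ : List Eqn) : Set where
  constructor same-occurrences
  field occE-≡ : ∀ x → occE x E ≡ occE x E′
open SameOccurrences

All-Solved-resp : ∀ {E E′ S} → SameOccurrences E E′ → All (Solved E) S → All (Solved E′) S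
All-Solved-resp same = All.map λ (z , l≡z , once) → z , l≡z , trans (sym (occE-≡ same z)) once

All-RhsLinear-resp : ∀ {E E′ U} → SameOccurrences E E′ → All (RhsLinear E) U → All (RhsLinear E′) U
All-RhsLinear-resp same = All.map λ lin x x∈r → trans (sym (occE-≡ same x)) (lin x x∈r)

SameOccurrences-in-context : ∀ S M M′ R → SameOccurrences M M′ → SameOccurrences (S ++ M ++ R) (S ++ M′ ++ R)
SameOccurrences-in-context S M M′ R same = same-occurrences λ x → begin
  occE x (S ++ M ++ R)              ≡⟨ occE-++ x S (M ++ R) ⟩
  occE x S + occE x (M ++ R)        ≡⟨ cong (occE x S +_) (occE-++ x M R) ⟩
  occE x S + (occE x M + occE x R)  ≡⟨ cong (λ n → occE x S + (n + occE x R)) (occE-≡ same x) ⟩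
  occE x S + (occE x M′ + occE x R) ≡⟨ cong (occE x S +_) (occE-++ x M′ R) ⟨
  occE x S + occE x (M′ ++ R)       ≡⟨ occE-++ x S (M′ ++ R) ⟨
  occE x (S ++ M′ ++ R)             ∎
  where open ≡-Reasoning

shift-invariant : ∀ S e R → All (Solved (S ++ e ∷ R)) S → Solved (S ++ e ∷ R) e →
                  All (RhsLinear (S ++ e ∷ R)) R → Invariant (S ++ e ∷ []) R
shift-invariant S e R solvedS solved-e linR = record
  { solved    = subst (λ E → All (Solved E) (S ++ e ∷ [])) reassoc (++⁺ solvedS (solved-e ∷ []))
  ; rhsLinear = subst (λ E → All (RhsLinear E) R) reassoc linR
  }
  where
  reassoc : S ++ e ∷ R ≡ (S ++ e ∷ []) ++ R
  reassoc = sym (++-assoc S (e ∷ []) R)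

solved-form-halts : ∀ E → All (Solved E) E → NoOccurRun E
solved-form-halts E solvedE = stop no-step no-clash no-occur-failure
  where
  solved-at : ∀ L e R → E ≡ L ++ e ∷ R → Solved E e
  solved-at L e R refl = All.lookup solvedE (∈-insert L)

  bound-at : ∀ L x t R → E ≡ L ++ (var x , t) ∷ R → occ x t ≡ 0 × occE x (L ++ R) ≡ 0
  bound-at L x t R refl with solved-at L _ R refl
  ... | _ , refl , once = bound-once x L t R once

  no-step : ∀ E′ → ¬ MMAStep E E′
  no-step _ (act1 L R f ss ts E≡ _) with solved-at L _ R E≡
  ... | _ , () , _
  no-step _ (act3 L R x E≡) = 1+n≢0 (trans (sym (δ-self x)) (proj₁ (bound-at L x (var x) R E≡)))
  no-step _ (act4 L R f ts x E≡) with solved-at L _ R E≡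
  ... | _ , () , _
  no-step _ (act5 L R x t E≡ _ x∈L++R) =
    <⇒≢ (∈ₑ⇒occE-pos (L ++ R) x∈L++R) (sym (proj₂ (bound-at L x t R E≡)))

  no-clash : ¬ Clash E
  no-clash (act2 L R f g ss ts E≡ _) with solved-at L _ R E≡
  ... | _ , () , _

  no-occur-failure : ¬ OccurFail E
  no-occur-failure (act6 L R x t E≡ x∈t _) =
    <⇒≢ (∈⇒occ-pos x∈t) (sym (proj₁ (bound-at L x t R E≡)))

zip-rhsLinear : ∀ E as ts → (∀ x → 0 < occ* x ts → occE x E ≡ 1) → All (RhsLinear E) (zip as ts)
zip-rhsLinear E []       ts       once = []
zip-rhsLinear E (a ∷ as) []       once = []
zip-rhsLinear E (a ∷ as) (t ∷ ts) once =
  (λ x x∈t → once x (≤-trans x∈t (m≤m+n _ _))) ∷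
  zip-rhsLinear E as ts (λ x x∈ts → once x (≤-trans x∈ts (m≤n+m _ _)))

data Progress (S U : List Eqn) : Set where
  halts : NoOccurRun (S ++ U) → Progress S U
  moves : ∀ S′ U′ → (NoOccurRun (S′ ++ U′) → NoOccurRun (S ++ U)) → Invariant S′ U′ →
          rhsSize U′ < rhsSize U → Progress S U

decompose : ∀ S f as g ts R → let E = S ++ (fn f as , fn g ts) ∷ R in
            All (Solved E) S → All (RhsLinear E) ((fn f as , fn g ts) ∷ R) → Progress S ((fn f as , fn g ts) ∷ R)
decompose S f as g ts R solvedS (lin-e ∷ linR) with f ≟ g | length as ≟ length ts
... | no f≢g   | _       = halts (clash (act2 S R f g as ts refl (inj₁ f≢g)))
... | yes refl | no len≢ = halts (clash (act2 S R f f as ts refl (inj₂ len≢)))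
... | yes refl | yes len = moves S (zip as ts ++ R) (step (act1 S R f as ts refl len)) invariant′ smaller
  where
  same : SameOccurrences (S ++ (fn f as , fn f ts) ∷ R) (S ++ zip as ts ++ R)
  same = SameOccurrences-in-context S (_ ∷ []) (zip as ts) R
           (same-occurrences λ x → trans (+-identityʳ _) (sym (occE-zip x as ts len)))

  invariant′ : Invariant S (zip as ts ++ R)
  invariant′ = record
    { solved    = All-Solved-resp same solvedS
    ; rhsLinear = ++⁺ (zip-rhsLinear (S ++ zip as ts ++ R) as ts
                        (λ x x∈ts → trans (sym (occE-≡ same x)) (lin-e x x∈ts)))
                      (All-RhsLinear-resp same linR)
    }

  smaller : rhsSize (zip as ts ++ R) < suc (size* ts) + rhsSize R
  smaller = s≤s (≤-trans (≤-reflexive (rhsSize-++ (zip as ts) R)) (+-monoˡ-≤ (rhsSize R) (rhsSize-zip as ts)))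

orient : ∀ S f as X R → let E = S ++ (fn f as , var X) ∷ R in
         All (Solved E) S → All (RhsLinear E) ((fn f as , var X) ∷ R) → Progress S ((fn f as , var X) ∷ R)
orient S f as X R solvedS (lin-e ∷ linR) =
  moves (S ++ e′ ∷ []) R (step (act4 S R f as X refl) ∘ subst NoOccurRun (++-assoc S (e′ ∷ []) R))
        (shift-invariant S e′ R (All-Solved-resp same solvedS) (X , refl , X-once)
                         (All-RhsLinear-resp same linR))
        (n<1+n (rhsSize R))
  where
  e′ : Eqn
  e′ = (var X , fn f as)

  same : SameOccurrences (S ++ (fn f as , var X) ∷ R) (S ++ e′ ∷ R)
  same = SameOccurrences-in-context S (_ ∷ []) (e′ ∷ []) R
           (same-occurrences λ x → cong (_+ 0) (+-comm (occ* x as) (δ x X)))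

  X-once : occE X (S ++ e′ ∷ R) ≡ 1
  X-once = trans (sym (occE-≡ same X)) (lin-e X (≤-reflexive (sym (δ-self X))))

module _ (S : List Eqn) (Z : ℕ) (h : Term) (R : List Eqn)
         (solvedS : All (Solved (S ++ (var Z , h) ∷ R)) S)
         (linU : All (RhsLinear (S ++ (var Z , h) ∷ R)) ((var Z , h) ∷ R)) where
  private
    e : Eqn
    e = (var Z , h)

    E : List Eqn
    E = S ++ e ∷ R

    Z∉h : occ Z h ≡ 0
    Z∉h with occ Z h ≟ 0
    ... | yes Z∉h = Z∉h
    ... | no  Z∈h = proj₁ (bound-once Z S h R (All.head linU Z (n≢0⇒n>0 Z∈h)))

  bind : Progress S (e ∷ R)
  bind with occE Z (S ++ R) ≟ 0
  ... | yes Z∉S++R =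
    moves (S ++ e ∷ []) R (subst NoOccurRun (++-assoc S (e ∷ []) R))
          (shift-invariant S e R solvedS (Z , refl , Z-once) (All.tail linU))
          (m<n+m (rhsSize R) (size-pos h))
    where
    Z-once : occE Z E ≡ 1
    Z-once = trans (occE-middle Z S e R) (cong₂ _+_ (cong₂ _+_ (δ-self Z) Z∉h) Z∉S++R)
  ... | no Z∈S++R =
    moves (map σ S ++ e ∷ []) (map σ R)
          (step (act5 S R Z h refl Z∉ᵥh (occE-pos⇒∈ₑ (S ++ R) (n≢0⇒n>0 Z∈S++R)))
            ∘ subst NoOccurRun (++-assoc (map σ S) (e ∷ []) (map σ R)))
          (shift-invariant (map σ S) e (map σ R) solved′ (Z , refl , Z-once′) linear′)
          smaller
    where
    σ : Eqn → Eqn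
    σ = substEq Z h

    E′ : List Eqn
    E′ = map σ S ++ e ∷ map σ R

    Z∉ᵥh : ¬ (Z ∈ᵥ h)
    Z∉ᵥh Z∈h = <⇒≢ (∈⇒occ-pos Z∈h) (sym Z∉h)

    Z-once′ : occE Z E′ ≡ 1
    Z-once′ = trans (occE-middle Z (map σ S) e (map σ R))
                    (cong₂ _+_ (cong₂ _+_ (δ-self Z) Z∉h)
                               (trans (cong (occE Z) (sym (map-++ σ S R))) (occE-[↦]-self (S ++ R) Z∉h)))

    occE-unchanged : ∀ y → y ≢ Z → occ y h ≡ 0 → occE y E′ ≡ occE y E
    occE-unchanged y y≢Z y∉h = begin
      occE y E′                               ≡⟨ occE-middle y (map σ S) e (map σ R) ⟩
      occₑ y e + occE y (map σ S ++ map σ R) ≡⟨ cong (λ F → occₑ y e + occE y F) (map-++ σ S R) ⟨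
      occₑ y e + occE y (map σ (S ++ R))     ≡⟨ cong (occₑ y e +_) (occE-[↦]-other (S ++ R) y≢Z y∉h) ⟩
      occₑ y e + occE y (S ++ R)             ≡⟨ occE-middle y S e R ⟨
      occE y E                                ∎
      where open ≡-Reasoning

    once-elsewhere⇒unaffected : ∀ y → occE y E ≡ 1 → 0 < occE y (S ++ R) → y ≢ Z × occ y h ≡ 0
    once-elsewhere⇒unaffected y once y∈S++R = δ≡0⇒≢ (m+n≡0⇒m≡0 _ y∉e) , m+n≡0⇒n≡0 (δ y Z) y∉e
      where
      y∉e : occₑ y e ≡ 0
      y∉e = once-elsewhere⇒absent-here y S e R once y∈S++R

    once-elsewhere-stays : ∀ y → occE y E ≡ 1 → 0 < occE y (S ++ R) → occE y E′ ≡ 1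
    once-elsewhere-stays y once y∈S++R with once-elsewhere⇒unaffected y once y∈S++R
    ... | y≢Z , y∉h = trans (occE-unchanged y y≢Z y∉h) once

    solved′ : All (Solved E′) (map σ S)
    solved′ = map⁺ (All.tabulate λ {e₀} e₀∈S → stays-solved e₀∈S (All.lookup solvedS e₀∈S))
      where
      stays-solved : ∀ {e₀} → e₀ ∈ S → Solved E e₀ → Solved E′ (σ e₀)
      stays-solved e₀∈S (y , refl , once) =
        y , [↦]-other h (proj₁ (once-elsewhere⇒unaffected y once y∈S++R)) , once-elsewhere-stays y once y∈S++R
        where
        y∈S++R : 0 < occE y (S ++ R)
        y∈S++R = lhs-occurs y (S ++ R) (∈-++⁺ˡ e₀∈S) (≤-reflexive (sym (δ-self y)))

    Z∉rhsR : All (λ e₀ → occ Z (proj₂ e₀) ≡ 0) R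
    Z∉rhsR = All.map (λ {e₀} → Z∉rhs {e₀}) (All.tail linU)
      where
      Z∉rhs : ∀ {e₀} → RhsLinear E e₀ → occ Z (proj₂ e₀) ≡ 0
      Z∉rhs {e₀} lin with occ Z (proj₂ e₀) ≟ 0
      ... | yes Z∉r = Z∉r
      ... | no  Z∈r = ⊥-elim (Z∈S++R (proj₂ (bound-once Z S h R (lin Z (n≢0⇒n>0 Z∈r)))))

    linear′ : All (RhsLinear E′) (map σ R)
    linear′ = map⁺ (All.tabulate stays-linear)
      where
      stays-linear : ∀ {e₀} → e₀ ∈ R → RhsLinear E′ (σ e₀)
      stays-linear {l , r} e₀∈R x x∈σr = once-elsewhere-stays x (All.lookup (All.tail linU) e₀∈R x x∈r)
                                           (rhs-occurs x (S ++ R) (∈-++⁺ʳ S e₀∈R) x∈r)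
        where
        x∈r : 0 < occ x r
        x∈r = subst (λ t → 0 < occ x t) ([↦]-fresh r (All.lookup Z∉rhsR e₀∈R)) x∈σr

    smaller : rhsSize (map σ R) < size h + rhsSize R
    smaller = subst (_< size h + rhsSize R) (sym (rhsSize-[↦]-fresh R Z∉rhsR)) (m<n+m (rhsSize R) (size-pos h))

progress : ∀ S U → Invariant S U → Progress S U
progress S []                          inv = halts (solved-form-halts (S ++ []) solved-all)
  where
  solved-all : All (Solved (S ++ [])) (S ++ [])
  solved-all = subst (All _) (sym (++-identityʳ S)) (solved inv)
progress S ((fn f as , fn g ts) ∷ R) inv = decompose S f as g ts R (solved inv) (rhsLinear inv)
progress S ((fn f as , var X) ∷ R)   inv = orient S f as X R (solved inv) (rhsLinear inv)
progress S ((var Z , h) ∷ R)         inv = bind S Z h R (solved inv) (rhsLinear inv)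

solve : ∀ n S U → rhsSize U ≤ n → Invariant S U → NoOccurRun (S ++ U)
solve n S U bound inv with progress S U inv
... | halts run = run
... | moves S′ U′ back inv′ smaller with n
...   | zero  = ⊥-elim (n≮0 (<-≤-trans smaller bound))
...   | suc m = back (solve m S′ U′ (≤-pred (<-≤-trans smaller bound)) inv′)

record Linear (t : Term) : Set where
  constructor linear
  field occ-linear : ∀ x → 0 < occ x t → occ x t ≡ 1

VarDisjoint : Term → Term → Set
VarDisjoint s t = ∀ x → 0 < occ x t → occ x s ≡ 0

linear-unification : ∀ s t → VarDisjoint s t → Linear t → NoOccurRun ((s , t) ∷ [])
linear-unification s t disjoint (linear lin) = solve (size t + 0) [] ((s , t) ∷ []) ≤-refl record
  { solved    = []
  ; rhsLinear = (λ x x∈t → trans (+-identityʳ _) (cong₂ _+_ (disjoint x x∈t) (lin x x∈t))) ∷ []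
  }

record LinearExcept (X : ℕ) (t : Term) : Set where
  constructor linear-except
  field occ-linear-except : ∀ x → x ≢ X → 0 < occ x t → occ x t ≡ 1

ground-binding-invariant :
  ∀ X a as ts → (∀ y → occ y a ≡ 0) → length as ≡ length ts →
  (∀ x → x ≢ X → 0 < occ* x ts → occ* x as ≡ 0 × occ* x ts ≡ 1) →
  Invariant ((var X , a) ∷ []) (map (substEq X a) (zip as ts))
ground-binding-invariant X a as ts a-closed len ts-linear = record
  { solved    = (X , refl , X-once) ∷ []
  ; rhsLinear = map⁺ (All.map (λ {e} → linear-under-σ {e}) (zip-rhsLinear E as ts ts-once))
  }
  where
  σ : Eqn → Eqn
  σ = substEq X a

  E : List Eqn
  E = (var X , a) ∷ map σ (zip as ts)

  X-once : occE X E ≡ 1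
  X-once = cong₂ _+_ (cong₂ _+_ (δ-self X) (a-closed X)) (occE-[↦]-self (zip as ts) (a-closed X))

  ts-once : ∀ x → 0 < occ* x ts → occE x E ≡ 1
  ts-once x x∈ts with x ≟ X
  ... | yes refl = X-once
  ... | no  x≢X  = begin
    (δ x X + occ x a) + occE x (map σ (zip as ts))
      ≡⟨ cong₂ _+_ (cong₂ _+_ (δ-other x≢X) (a-closed x)) (occE-[↦]-other (zip as ts) x≢X (a-closed x)) ⟩
    occE x (zip as ts)
      ≡⟨ occE-zip x as ts len ⟩
    occ* x as + occ* x ts
      ≡⟨ cong₂ _+_ (proj₁ (ts-linear x x≢X x∈ts)) (proj₂ (ts-linear x x≢X x∈ts)) ⟩
    1
      ∎
    where open ≡-Reasoning

  linear-under-σ : ∀ {e} → RhsLinear E e → RhsLinear E (σ e)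
  linear-under-σ {l , r} lin x x∈σr = lin x (subst (0 <_) (occ-[↦]-other r x≢X (a-closed x)) x∈σr)
    where
    x≢X : x ≢ X
    x≢X refl = <⇒≢ x∈σr (sym (occ-[↦]-self r (a-closed X)))

ground-binding-unification :
  ∀ p as X ts → All Ground (take 1 as) → VarDisjoint (fn p as) (fn p (var X ∷ ts)) → 0 < occ* X ts →
  LinearExcept X (fn p (var X ∷ ts)) → NoOccurRun ((fn p as , fn p (var X ∷ ts)) ∷ [])
ground-binding-unification p []             X ts _ _ _ _ = clash (act2 [] [] p p [] _ refl (inj₂ λ ()))
ground-binding-unification p (var y ∷ as)   X ts (ground ∷ []) = ⊥-elim (ground y here)
ground-binding-unification p (fn f bs ∷ as) X ts (ground ∷ []) disjoint X∈ts (linear-except lin)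
  with length as ≟ length ts
... | no len≢ = clash (act2 [] [] p p _ _ refl (inj₂ (len≢ ∘ suc-injective)))
... | yes len =
  step (act1 [] [] p _ _ refl (cong suc len))
    (subst NoOccurRun (cong (_ ∷_) (sym (++-identityʳ (zip as ts))))
      (step (act4 [] (zip as ts) f bs X refl)
        (step (act5 [] (zip as ts) X a refl (ground X) X∈zip)
          (solve _ _ _ ≤-refl (ground-binding-invariant X a as ts a-closed len ts-linear)))))
  where
  a : Term
  a = fn f bs

  a-closed : ∀ y → occ y a ≡ 0
  a-closed y = ∉⇒occ≡0 a (ground y)

  X∈zip : Any (X ∈ₑ_) (zip as ts)
  X∈zip = occE-pos⇒∈ₑ (zip as ts) (subst (0 <_) (sym (occE-zip X as ts len)) (≤-trans X∈ts (m≤n+m _ _)))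

  ts-linear : ∀ x → x ≢ X → 0 < occ* x ts → occ* x as ≡ 0 × occ* x ts ≡ 1
  ts-linear x x≢X x∈ts =
    m+n≡0⇒n≡0 (occ x a) (disjoint x x∈t) , trans (cong (_+ occ* x ts) (sym (δ-other x≢X))) (lin x x≢X x∈t)
    where
    x∈t : 0 < δ x X + occ* x ts
    x∈t = ≤-trans x∈ts (m≤n+m _ _)

-- Renaming apart

ren : (ℕ → ℕ) → Subst
ren ρ x = var (ρ x)

mutual
  occ-ren : ∀ {ρ} → Injective _≡_ _≡_ ρ → ∀ j t → occ (ρ j) (t ⟨ ren ρ ⟩) ≡ occ j t
  occ-ren {ρ} inj j (var i) with j ≟ i
  ... | yes refl = trans (δ-self (ρ j)) (sym (δ-self j))
  ... | no  j≢i  = trans (δ-other (j≢i ∘ inj)) (sym (δ-other j≢i))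
  occ-ren inj j (fn f ts) = occ*-ren inj j ts

  occ*-ren : ∀ {ρ} → Injective _≡_ _≡_ ρ → ∀ j ts → occ* (ρ j) (ts ⟨ ren ρ ⟩*) ≡ occ* j ts
  occ*-ren inj j []       = refl
  occ*-ren inj j (t ∷ ts) = cong₂ _+_ (occ-ren inj j t) (occ*-ren inj j ts)

mutual
  occ-ren-image : ∀ ρ t {x} → 0 < occ x (t ⟨ ren ρ ⟩) → ∃[ j ] (x ≡ ρ j)
  occ-ren-image ρ (var i)   x∈ = i , δ-pos⇒≡ x∈
  occ-ren-image ρ (fn f ts) x∈ = occ*-ren-image ρ ts x∈

  occ*-ren-image : ∀ ρ ts {x} → 0 < occ* x (ts ⟨ ren ρ ⟩*) → ∃[ j ] (x ≡ ρ j)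
  occ*-ren-image ρ (t ∷ ts) {x} x∈ with +-pos (occ x (t ⟨ ren ρ ⟩)) _ x∈
  ... | inj₁ x∈t  = occ-ren-image ρ t x∈t
  ... | inj₂ x∈ts = occ*-ren-image ρ ts x∈ts

Linear-ren : ∀ {ρ} → Injective _≡_ _≡_ ρ → ∀ t → Linear t → Linear (t ⟨ ren ρ ⟩)
Linear-ren {ρ} inj t (linear lin) = linear λ x x∈ → renamed x x∈
  where
  renamed : ∀ x → 0 < occ x (t ⟨ ren ρ ⟩) → occ x (t ⟨ ren ρ ⟩) ≡ 1
  renamed x x∈ with occ-ren-image ρ t x∈
  ... | j , refl = trans (occ-ren inj j t) (lin j (subst (0 <_) (occ-ren inj j t) x∈))

LinearExcept-ren : ∀ {ρ} → Injective _≡_ _≡_ ρ → ∀ X t → LinearExcept X t →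
                   LinearExcept (ρ X) (t ⟨ ren ρ ⟩)
LinearExcept-ren {ρ} inj X t (linear-except lin) = linear-except λ x x≢ρX x∈ → renamed x x≢ρX x∈
  where
  renamed : ∀ x → x ≢ ρ X → 0 < occ x (t ⟨ ren ρ ⟩) → occ x (t ⟨ ren ρ ⟩) ≡ 1
  renamed x x≢ρX x∈ with occ-ren-image ρ t x∈
  ... | j , refl = trans (occ-ren inj j t) (lin j (x≢ρX ∘ cong ρ) (subst (0 <_) (occ-ren inj j t) x∈))

-- NQUEENS

pqs-base-head-linear : Linear (atomTerm (pqs zeroT (v 0) (v 1) (v 2)))
pqs-base-head-linear = linear λ where
  0 _ → refl
  1 _ → refl
  2 _ → refl
  (suc (suc (suc _))) ()

pqs-step-head-linear : Linear (atomTerm (pqs (sT (v 0)) (v 1) (v 2) (cons (v 3) (v 4))))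
pqs-step-head-linear = linear λ where
  0 _ → refl
  1 _ → refl
  2 _ → refl
  3 _ → refl
  4 _ → refl
  (suc (suc (suc (suc (suc _))))) ()

pq-place-head-linear-except-0 :
  LinearExcept 0 (atomTerm (pq (v 0) (cons (v 0) (v 1)) (cons (v 0) (v 2)) (cons (v 0) (v 3))))
pq-place-head-linear-except-0 = linear-except λ where
  0 0≢0 _ → ⊥-elim (0≢0 refl)
  1 _   _ → refl
  2 _   _ → refl
  3 _   _ → refl
  (suc (suc (suc (suc _)))) _ ()

pq-skip-head-linear : Linear (atomTerm (pq (v 0) (cons (v 1) (v 2)) (cons (v 3) (v 4)) (cons (v 5) (v 6))))
pq-skip-head-linear = linear λ where
  0 _ → refl
  1 _ → refl
  2 _ → refl
  3 _ → refl
  4 _ → refl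
  5 _ → refl
  6 _ → refl
  (suc (suc (suc (suc (suc (suc (suc _))))))) ()

nqueens-head-unification :
  ∀ {c ρ} → c ∈ NQUEENS → Injective _≡_ _≡_ ρ → ∀ A → OneGroundAtom A →
  VarDisjoint (atomTerm A) (atomTerm (head c) ⟨ ren ρ ⟩) → pred A ≡ pred (head c) →
  NoOccurRun ((atomTerm A , atomTerm (head c) ⟨ ren ρ ⟩) ∷ [])
nqueens-head-unification (here refl) inj A _ disjoint _ =
  linear-unification _ _ disjoint (Linear-ren inj _ pqs-base-head-linear)
nqueens-head-unification (there (here refl)) inj A _ disjoint _ =
  linear-unification _ _ disjoint (Linear-ren inj _ pqs-step-head-linear)
nqueens-head-unification {ρ = ρ} (there (there (here refl))) inj (p ⦅ as ⦆) one-ground disjoint refl =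
  ground-binding-unification 1 as (ρ 0) _ one-ground disjoint
    (subst (0 <_) (sym (occ*-ren inj 0 (cons (v 0) (v 1) ∷ cons (v 0) (v 2) ∷ cons (v 0) (v 3) ∷ [])))
           (s≤s z≤n))
    (LinearExcept-ren inj 0 _ pq-place-head-linear-except-0)
nqueens-head-unification (there (there (there (here refl)))) inj A _ disjoint _ =
  linear-unification _ _ disjoint (Linear-ren inj _ pq-skip-head-linear)

mutual
  ground-fixed : ∀ t σ → Ground t → t ⟨ σ ⟩ ≡ t
  ground-fixed (var x)   σ ground = ⊥-elim (ground x here)
  ground-fixed (fn f ts) σ ground = cong (fn f) (ground*-fixed ts σ (λ x → ground x ∘ inside))

  ground*-fixed : ∀ ts σ → (∀ x → ¬ Any (x ∈ᵥ_) ts) → ts ⟨ σ ⟩* ≡ ts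
  ground*-fixed []       σ ground = refl
  ground*-fixed (t ∷ ts) σ ground =
    cong₂ _∷_ (ground-fixed t σ (λ x → ground x ∘ here)) (ground*-fixed ts σ (λ x → ground x ∘ there))

ground-⟨⟩ : ∀ {t} σ → Ground t → Ground (t ⟨ σ ⟩)
ground-⟨⟩ {t} σ ground = subst Ground (sym (ground-fixed t σ ground)) ground

OneGroundAtom-⟨⟩ : ∀ θ A → OneGroundAtom A → OneGroundAtom (A ⟨ θ ⟩ₐ)
OneGroundAtom-⟨⟩ θ (p ⦅ [] ⦆)     []           = []
OneGroundAtom-⟨⟩ θ (p ⦅ a ∷ as ⦆) (ground ∷ []) = ground-⟨⟩ θ ground ∷ []

unified-first-arg-ground : ∀ θ A {t ts} → OneGroundAtom A → args A ⟨ θ ⟩* ≡ t ∷ ts → Ground t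
unified-first-arg-ground θ (p ⦅ a ∷ as ⦆) (ground ∷ []) refl = ground-⟨⟩ θ ground

Ground-sT⁻¹ : ∀ {t} → Ground (sT t) → Ground t
Ground-sT⁻¹ ground x = ground x ∘ inside ∘ here

nqueens-body-1-ground :
  ∀ {c} θ ρ A → c ∈ NQUEENS → OneGroundAtom A → A ⟨ θ ⟩ₐ ≡ head (c ⟨ ren ρ ⟩c) ⟨ θ ⟩ₐ →
  All (λ B → OneGroundAtom (B ⟨ θ ⟩ₐ)) (body (c ⟨ ren ρ ⟩c))
nqueens-body-1-ground θ ρ A (here refl)                         _          _       = []
nqueens-body-1-ground θ ρ A (there (here refl))                 one-ground unifies =
  (Ground-sT⁻¹ sI-ground ∷ []) ∷ (sI-ground ∷ []) ∷ []
  where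
  sI-ground : Ground (sT (θ (ρ 0)))
  sI-ground = unified-first-arg-ground θ A one-ground (cong args unifies)
nqueens-body-1-ground θ ρ A (there (there (here refl)))         _          _       = []
nqueens-body-1-ground θ ρ A (there (there (there (here refl)))) one-ground unifies =
  (unified-first-arg-ground θ A one-ground (cong args unifies) ∷ []) ∷ []

node-1-ground : ∀ {R Q₀ h Q} → OneGround Q₀ → Node NQUEENS R Q₀ h Q → OneGround Q
node-1-ground one-ground root = one-ground
node-1-ground {R} one-ground (child {h} {A} {As} {c} {θ = θ} node c∈P (ρ , _ , refl) _ (unifies , _)) =
  map⁺ (++⁺ (take⁺ i query-1-ground) (++⁺ body-1-ground (drop⁺ (suc i) query-1-ground)))
  where
  i : ℕ
  i = toℕ (R h A As)

  query-1-ground : All (λ B → OneGroundAtom (B ⟨ θ ⟩ₐ)) (A ∷ As)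
  query-1-ground = All.map (λ {B} → OneGroundAtom-⟨⟩ θ B) (node-1-ground one-ground node)

  body-1-ground : All (λ B → OneGroundAtom (B ⟨ θ ⟩ₐ)) (body (c ⟨ ren ρ ⟩c))
  body-1-ground = nqueens-body-1-ground θ ρ _ c∈P
                    (All.lookup (node-1-ground one-ground node) (∈-lookup (R h A As))) unifies

standardized-apart-disjoint : ∀ {c′ h Q A} → StandardizedApart c′ h Q → A ∈ Q →
                              VarDisjoint (atomTerm A) (atomTerm (head c′))
standardized-apart-disjoint {A = A} apart A∈Q x x∈H =
  ∉⇒occ≡0 (atomTerm A) λ where
    (inside x∈A) → proj₂ (apart x (inj₁ (occ*-pos⇒∈* _ x∈H))) (lose A∈Q x∈A)

proposition15 : (R : SelRule) (Q : Query) → OneGround Q →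
    WeaklyOccurCheckFree NQUEENS R Q
proposition15 R Q one-ground A _
  (h , B , Bs , node , A≡selected , c , _ , c∈P , (ρ , ρ-injective , refl) , apart , refl , same-pred) =
  nqueens-head-unification c∈P ρ-injective A A-1-ground
    (standardized-apart-disjoint {c ⟨ ren ρ ⟩c} apart A∈query) same-pred
  where
  A∈query : A ∈ B ∷ Bs
  A∈query = subst (_∈ B ∷ Bs) (sym A≡selected) (∈-lookup (R h B Bs))

  A-1-ground : OneGroundAtom A
  A-1-ground = All.lookup (node-1-ground one-ground node) A∈query
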